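{- Let $G$ be a $P_4$-sparse graph consisting of exactly two connected components with vertex sets $C_u\ni u$ and $C_v\ni v$. If there exists an optimal solution $H$ of the ($P_4$-sparse-2CC,$+1$)-MinEdgeAddition Problem for $G$ and the non-edge $uv$ such that the root node of the $P_4$-sparse tree of $H$ is a $2$-node corresponding to a thick spider with spider partition $(S,K,R)$, $|S|=|K|\ge3$, with at least one of $u,v$ in $S\cup K$, then there exists an optimal solution of the same problem which results from making $u$ or $v$ universal in $G$.
   Context: All graphs are finite, simple, undirected. A graph is $P_4$-sparse if no five vertices induce more than one $P_4$. A spider is a graph with vertex partition $(S,K,R)$ (spider partition), $S$ independent, $K$ a clique, $|S|=|K|\ge2$, $R$ complete to $K$ and anticomplete to $S$, and a bijection $f:S\to K$ with either $N(s)\cap K=\{f(s)\}$ for all $s$ (thin) or $N(s)\cap K=K\setminus\{f(s)\}$ for all $s$ (thick); by convention thick spiders have $|S|=|K|\ge3$. Every $P_4$-sparse graph has a unique $P_4$-sparse tree: a rooted tree whose leaves correspond bijectively to the vertices, internal nodes have at least two children and labels $0,1,2$ differing from the parent's; two vertices are non-adjacent (adjacent) if the least common ancestor of their leaves is a $0$-node ($1$-node), and leaves below a $2$-node induce a spider (the spider corresponding to that node). "Making $u$ universal in $G$" means adding all edges from $u$ to its non-neighbours. ($P_4$-sparse-2CC,$+1$)-MinEdgeAddition Problem: $G$ is $P_4$-sparse with exactly two connected components $C_u\ni u$, $C_v\ni v$; a solution is a $P_4$-sparse $H$ with $V(H)=V(G)$, $E(G)\cup\{uv\}\subseteq E(H)$;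 fill edges are $E(H)\setminus E(G)$ (including $uv$); optimal solutions minimize their number. -}

module Defs where

open import Data.Nat using (ℕ; _<ᵇ_; _≤_)
open import Data.Bool using (Bool; true; false; _∧_; _∨_; not; if_then_else_)
open import Data.Fin using (Fin; toℕ; _≟_)
open import Data.Fin.Subset using (Subset; _∈_; _∉_; _⊆_; _∪_; ⁅_⁆; ∣_∣)
open import Data.List using (List; map; allFin; cartesianProduct)
open import Data.Nat.ListAction using (sum)
open import Data.Product using (Σ; ∃; _×_; _,_)
open import Data.Sum using (_⊎_)
open import Relation.Nullary using (¬_; ⌊_⌋)
open import Relation.Binary.PropositionalEquality using (_≡_; _≢_)

Adj : ℕ → Set
Adj n = Fin n → Fin n → Bool

record IsGraph {n : ℕ} (G : Adj n) : Set where
  field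
    sym    : ∀ x y → G x y ≡ G y x
    irrefl : ∀ x → G x x ≡ false

InducesP4 : ∀ {n} → Adj n → Subset n → Set
InducesP4 {n} G X =
  Σ (Fin n) λ a → Σ (Fin n) λ b → Σ (Fin n) λ c → Σ (Fin n) λ d →
    (a ≢ b) × (a ≢ c) × (a ≢ d) × (b ≢ c) × (b ≢ d) × (c ≢ d) ×
    (X ≡ (⁅ a ⁆ ∪ ⁅ b ⁆) ∪ (⁅ c ⁆ ∪ ⁅ d ⁆)) ×
    (G a b ≡ true) × (G b c ≡ true) × (G c d ≡ true) ×
    (G a c ≡ false) × (G a d ≡ false) × (G b d ≡ false)

-- P4-sparse: no five vertices induce more than one P4, i.e. any two
-- P4-inducing 4-sets contained in a common 5-set coincide.
P4Sparse : ∀ {n} → Adj n → Set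
P4Sparse {n} G = ∀ (Z X Y : Subset n) → ∣ Z ∣ ≡ 5 → X ⊆ Z → Y ⊆ Z →
  InducesP4 G X → InducesP4 G Y → X ≡ Y

data Reach {n : ℕ} (G : Adj n) : Fin n → Fin n → Set where
  here : ∀ {x} → Reach G x x
  step : ∀ {x y z} → G x y ≡ true → Reach G y z → Reach G x z

-- G has exactly two connected components, one containing u and the other v
-- (C_u = vertices reachable from u, C_v = vertices reachable from v)
TwoComponents : ∀ {n} → Adj n → Fin n → Fin n → Set
TwoComponents {n} G u v = (¬ Reach G u v) × (∀ w → Reach G u w ⊎ Reach G v w)

IsThickSpider : ∀ {n} → Adj n → Subset n → Subset n → Subset n → Set
IsThickSpider {n} H S K R =
  (∀ x → (x ∈ S × x ∉ K × x ∉ R) ⊎ (x ∉ S × x ∈ K × x ∉ R) ⊎ (x ∉ S × x ∉ K × x ∈ R)) ×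
  (∀ x y → x ∈ S → y ∈ S → H x y ≡ false) ×
  (∀ x y → x ∈ K → y ∈ K → x ≢ y → H x y ≡ true) ×
  (∣ S ∣ ≡ ∣ K ∣) × (3 ≤ ∣ S ∣) ×
  (∀ r k → r ∈ R → k ∈ K → H r k ≡ true) ×
  (∀ r s → r ∈ R → s ∈ S → H r s ≡ false) ×
  (Σ (Fin n → Fin n) λ f →
     (∀ s → s ∈ S → f s ∈ K) ×
     (∀ s s′ → s ∈ S → s′ ∈ S → f s ≡ f s′ → s ≡ s′) ×
     (∀ k → k ∈ K → Σ (Fin n) λ s → s ∈ S × f s ≡ k) ×
     (∀ s k → s ∈ S → k ∈ K → (H s k ≡ true → k ≢ f s) × (k ≢ f s → H s k ≡ true)))

Solution : ∀ {n} → Adj n → Fin n → Fin n → Adj n → Set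
Solution {n} G u v H =
  IsGraph H × P4Sparse H × (∀ x y → G x y ≡ true → H x y ≡ true) × (H u v ≡ true)

-- number of fill edges E(H) ∖ E(G) (unordered pairs counted once)
fillCount : ∀ {n} → Adj n → Adj n → ℕ
fillCount {n} G H = sum (map cnt (cartesianProduct (allFin n) (allFin n)))
  where
  cnt : Fin n × Fin n → ℕ
  cnt (i , j) = if (toℕ i <ᵇ toℕ j) ∧ H i j ∧ not (G i j) then 1 else 0

Optimal : ∀ {n} → Adj n → Fin n → Fin n → Adj n → Set
Optimal {n} G u v H =
  Solution G u v H × (∀ H′ → Solution G u v H′ → fillCount G H ≤ fillCount G H′)

makeUniversal : ∀ {n} → Adj n → Fin n → Adj n
makeUniversal G u x y =
  G x y ∨ (not ⌊ x ≟ y ⌋ ∧ (⌊ x ≟ u ⌋ ∨ ⌊ y ≟ u ⌋))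

{-# OPTIONS --safe #-}
module Submission where

-- Let x ∈ {u, v} lie in the clique K of the thick spider H (an edge of H with an end in S ∪ K has an end in
-- K) and let y be the other endpoint. In a thick spider, x is adjacent to every vertex except its partner
-- s ∈ S. If H has a fill edge avoiding x, making x universal costs no more than H: the edges it adds all
-- meet x and, except possibly {x, s}, are fill edges of H, while {x, s} is paid for by that other edge.
-- Otherwise every edge of H − x is an edge of G; since K ∖ {x} dominates H − x, all vertices other than x
-- lie in one component of G. As x and y lie in different components, x is isolated in G while y has a
-- neighbour z, and then making y universal adds at most the n − 2 edges from y to vertices other than z,
-- whereas H already contains the n − 2 fill edges from x to vertices other than s.

open import Defs
open import Data.Nat using (ℕ; zero; suc; _+_; _≤_; _<_; _<ᵇ_; z≤n; s≤s)
open import Data.Nat.Properties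
  using ( ≤-refl; ≤-trans; ≤-reflexive; +-mono-≤; +-monoʳ-≤; n≤1+n; +-identityʳ; +-suc; m≤n+m; <-cmp; <-asym
        ; <-irrefl; +-cancelʳ-≤; +-cancelʳ-≡; <ᵇ⇒<; <⇒<ᵇ; +-0-commutativeMonoid; module ≤-Reasoning)
open import Data.Nat.ListAction using () renaming (sum to listSum)
open import Data.Nat.ListAction.Properties using () renaming (sum-++ to listSum-++)
open import Algebra.Properties.CommutativeMonoid.Sum +-0-commutativeMonoid
  using (sum-syntax; ∑-distrib-+; sum-remove; sum-cong-≗; sum-replicate-zero)
open import Data.Bool using (Bool; true; false; _∧_; _∨_; not; if_then_else_)
import Data.Bool as Bool
open import Data.Bool.Properties using (T-≡; ∧-zeroʳ; ∧-inverseʳ; ∨-zeroʳ; ∨-identityʳ; ∨-comm)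
open import Data.Fin using (Fin; zero; suc; toℕ; _≟_; punchIn)
open import Data.Fin.Properties using (any?; toℕ-injective; punchInᵢ≢i)
open import Data.Fin.Subset using (Subset; _∈_; _⊆_; _∪_; ⁅_⁆; ∣_∣)
open import Data.Fin.Subset.Properties using (_∈?_; x∈p∪q⁻; x∈p∪q⁺; x∈⁅x⁆; p⊆q⇒∣p∣≤∣q∣; ∣⁅x⁆∣≡1)
open import Data.List using ([]; _∷_; _++_; map; allFin; tabulate; cartesianProduct)
open import Data.List.Properties using (map-++; map-∘; map-cong; map-tabulate)
open import Data.Vec using ([]; _∷_)
open import Data.Product using (∃-syntax; ∃₂; _×_; _,_; proj₁; proj₂)
open import Data.Sum using (_⊎_; inj₁; inj₂; swap; [_,_]′) renaming (map to ⊎-map)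
open import Data.Empty using (⊥; ⊥-elim)
open import Function using (_∘_; flip; Equivalence)
open import Relation.Nullary using (Dec; yes; no; ¬_; ⌊_⌋; ¬?; _×-dec_; contradiction)
open import Relation.Binary using (tri<; tri≈; tri>)
open import Relation.Binary.PropositionalEquality
  using (_≡_; _≢_; refl; sym; trans; cong; cong₂; subst; module ≡-Reasoning)

⟦_⟧ : Bool → ℕ
⟦ b ⟧ = if b then 1 else 0

∧-intro : ∀ {a b} → a ≡ true → b ≡ true → a ∧ b ≡ true
∧-intro refl refl = refl

∧-elim : ∀ {a b} → a ∧ b ≡ true → a ≡ true × b ≡ true
∧-elim {true} b≡true = refl , b≡true

not-true⁻¹ : ∀ {b} → not b ≡ true → b ≡ false
not-true⁻¹ {false} _ = refl

true≢false : ∀ {b} → b ≡ true → b ≢ false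
true≢false refl ()

module _ {A : Set} where

  ⌊⌋-true : (a? : Dec A) → A → ⌊ a? ⌋ ≡ true
  ⌊⌋-true (yes _) _ = refl
  ⌊⌋-true (no ¬a) a = contradiction a ¬a

  ⌊⌋-false : (a? : Dec A) → ¬ A → ⌊ a? ⌋ ≡ false
  ⌊⌋-false (yes a) ¬a = contradiction a ¬a
  ⌊⌋-false (no _) _ = refl

  ⌊⌋-true⁻¹ : (a? : Dec A) → ⌊ a? ⌋ ≡ true → A
  ⌊⌋-true⁻¹ (yes a) _ = a

  not⌊⌋-true⁻¹ : (a? : Dec A) → not ⌊ a? ⌋ ≡ true → ¬ A
  not⌊⌋-true⁻¹ (no ¬a) _ = ¬a

<ᵇ-true : ∀ {m n} → m < n → (m <ᵇ n) ≡ true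
<ᵇ-true m<n = Equivalence.to T-≡ (<⇒<ᵇ m<n)

<ᵇ-true⁻¹ : ∀ {m n} → (m <ᵇ n) ≡ true → m < n
<ᵇ-true⁻¹ {m} {n} e = <ᵇ⇒< m n (Equivalence.from T-≡ e)

<ᵇ-false : ∀ {m n} → ¬ m < n → (m <ᵇ n) ≡ false
<ᵇ-false {m} {n} m≮n with m <ᵇ n in e
... | true = contradiction (<ᵇ-true⁻¹ e) m≮n
... | false = refl

⟦⟧-≤-+ : ∀ {b c d} → (b ≡ true → c ≡ true ⊎ d ≡ true) → ⟦ b ⟧ ≤ ⟦ c ⟧ + ⟦ d ⟧
⟦⟧-≤-+ {false} _ = z≤n
⟦⟧-≤-+ {true} {c} b⇒c∨d with b⇒c∨d refl
... | inj₁ refl = s≤s z≤n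
... | inj₂ refl = m≤n+m 1 ⟦ c ⟧

⟦⟧-+-≤ : ∀ {b c d} → (b ≡ true → d ≡ true) → (c ≡ true → d ≡ true) →
  (b ≡ true → c ≡ true → ⊥) → ⟦ b ⟧ + ⟦ c ⟧ ≤ ⟦ d ⟧
⟦⟧-+-≤ {false} {false} _ _ _ = z≤n
⟦⟧-+-≤ {false} {true} _ c⇒d _ rewrite c⇒d refl = ≤-refl
⟦⟧-+-≤ {true} {false} b⇒d _ _ rewrite b⇒d refl = ≤-refl
⟦⟧-+-≤ {true} {true} _ _ disjoint = ⊥-elim (disjoint refl refl)

⟦⟧-exchange : ∀ {m d h e} → (m ≡ true → h ≡ true ⊎ e ≡ true) → (d ≡ true → m ≡ false × h ≡ true) →
  ⟦ m ⟧ + ⟦ d ⟧ ≤ ⟦ h ⟧ + ⟦ e ⟧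
⟦⟧-exchange {m} {false} m⇒h∨e _ = ≤-trans (≤-reflexive (+-identityʳ ⟦ m ⟧)) (⟦⟧-≤-+ m⇒h∨e)
⟦⟧-exchange {d = true} _ d⇒¬m∧h with d⇒¬m∧h refl
... | refl , refl = s≤s z≤n

∑-mono : ∀ {n} {f g : Fin n → ℕ} → (∀ i → f i ≤ g i) → ∑[ i < n ] f i ≤ ∑[ i < n ] g i
∑-mono {zero} _ = z≤n
∑-mono {suc n} f≤g = +-mono-≤ (f≤g zero) (∑-mono (f≤g ∘ suc))

∑-one : ∀ n → ∑[ i < n ] 1 ≡ n
∑-one zero = refl
∑-one (suc n) = cong suc (∑-one n)

∑-delta : ∀ {n} (a : Fin n) (k : ℕ) → ∑[ i < n ] (if ⌊ i ≟ a ⌋ then k else 0) ≡ k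
∑-delta {suc n} a k = begin
  ∑[ i < suc n ] spike i                   ≡⟨ sum-remove {i = a} spike ⟩
  spike a + ∑[ j < n ] spike (punchIn a j) ≡⟨ cong₂ _+_ (cong (if_then k else 0) (⌊⌋-true (a ≟ a) refl)) off-a ⟩
  k + 0                                    ≡⟨ +-identityʳ k ⟩
  k                                        ∎
  where
  open ≡-Reasoning
  spike : Fin (suc n) → ℕ
  spike i = if ⌊ i ≟ a ⌋ then k else 0
  off-a : ∑[ j < n ] spike (punchIn a j) ≡ 0
  off-a = trans (sum-cong-≗ λ j → cong (if_then k else 0) (⌊⌋-false (punchIn a j ≟ a) (punchInᵢ≢i a j)))
                (sum-replicate-zero n)

listSum-tabulate : ∀ {n} (f : Fin n → ℕ) → listSum (tabulate f) ≡ ∑[ i < n ] f i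
listSum-tabulate {zero} f = refl
listSum-tabulate {suc n} f = cong (f zero +_) (listSum-tabulate (f ∘ suc))

listSum-allFin : ∀ {n} (f : Fin n → ℕ) → listSum (map f (allFin n)) ≡ ∑[ i < n ] f i
listSum-allFin {n} f = trans (cong listSum (map-tabulate (λ i → i) f)) (listSum-tabulate f)

listSum-cartesianProduct : ∀ {A B : Set} (w : A × B → ℕ) xs ys →
  listSum (map w (cartesianProduct xs ys)) ≡ listSum (map (λ x → listSum (map (λ y → w (x , y)) ys)) xs)
listSum-cartesianProduct w [] ys = refl
listSum-cartesianProduct w (x ∷ xs) ys = begin
  listSum (map w (map (x ,_) ys ++ cartesianProduct xs ys))
    ≡⟨ cong listSum (map-++ w (map (x ,_) ys) _) ⟩
  listSum (map w (map (x ,_) ys) ++ map w (cartesianProduct xs ys))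
    ≡⟨ listSum-++ (map w (map (x ,_) ys)) _ ⟩
  listSum (map w (map (x ,_) ys)) + listSum (map w (cartesianProduct xs ys))
    ≡⟨ cong₂ _+_ (cong listSum (sym (map-∘ ys))) (listSum-cartesianProduct w xs ys) ⟩
  _ ∎
  where
  open ≡-Reasoning

∑² : ∀ {n} → (Fin n → Fin n → ℕ) → ℕ
∑² {n} w = ∑[ i < n ] ∑[ j < n ] w i j

∑²-mono : ∀ {n} {v w : Fin n → Fin n → ℕ} → (∀ i j → v i j ≤ w i j) → ∑² v ≤ ∑² w
∑²-mono v≤w = ∑-mono λ i → ∑-mono (v≤w i)

∑²-distrib-+ : ∀ {n} (v w : Fin n → Fin n → ℕ) → ∑² (λ i j → v i j + w i j) ≡ ∑² v + ∑² w
∑²-distrib-+ {n} v w = trans (sum-cong-≗ λ i → ∑-distrib-+ (v i) (w i))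
                             (∑-distrib-+ (λ i → ∑[ j < n ] v i j) (λ i → ∑[ j < n ] w i j))

∑²-row : ∀ {n} (y : Fin n) (r : Fin n → Fin n → Bool) →
  ∑² (λ i j → ⟦ ⌊ i ≟ y ⌋ ∧ r i j ⟧) ≡ ∑[ j < n ] ⟦ r y j ⟧
∑²-row {n} y r = trans (sum-cong-≗ row-y) (∑-delta y _)
  where
  row-y : ∀ i → ∑[ j < n ] ⟦ ⌊ i ≟ y ⌋ ∧ r i j ⟧ ≡ (if ⌊ i ≟ y ⌋ then ∑[ j < n ] ⟦ r y j ⟧ else 0)
  row-y i with i ≟ y
  ... | yes refl = refl
  ... | no _ = sum-replicate-zero n

∑²-column : ∀ {n} (y : Fin n) (r : Fin n → Fin n → Bool) →
  ∑² (λ i j → ⟦ ⌊ j ≟ y ⌋ ∧ r i j ⟧) ≡ ∑[ i < n ] ⟦ r i y ⟧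
∑²-column {n} y r = sum-cong-≗ λ i → trans (sum-cong-≗ (entry i)) (∑-delta y _)
  where
  entry : ∀ i j → ⟦ ⌊ j ≟ y ⌋ ∧ r i j ⟧ ≡ (if ⌊ j ≟ y ⌋ then ⟦ r i y ⟧ else 0)
  entry i j with j ≟ y
  ... | yes refl = refl
  ... | no _ = refl

δ : ∀ {n} → Fin n → Fin n → Fin n → Fin n → ℕ
δ a b i j = ⟦ ⌊ i ≟ a ⌋ ∧ ⌊ j ≟ b ⌋ ⟧

∑²-δ : ∀ {n} (a b : Fin n) → ∑² (δ a b) ≡ 1
∑²-δ a b = trans (∑²-row a (λ _ j → ⌊ j ≟ b ⌋)) (∑-delta b 1)

∑²-exchange : ∀ {n} {v w : Fin n → Fin n → ℕ} (a b c d : Fin n) →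
  (∀ i j → v i j + δ a b i j ≤ w i j + δ c d i j) → ∑² v ≤ ∑² w
∑²-exchange {v = v} {w} a b c d pointwise = +-cancelʳ-≤ 1 (∑² v) (∑² w) (begin
  ∑² v + 1                                 ≡⟨ cong (∑² v +_) (sym (∑²-δ a b)) ⟩
  ∑² v + ∑² (δ a b)                        ≡⟨ sym (∑²-distrib-+ v (δ a b)) ⟩
  ∑² (λ i j → v i j + δ a b i j)           ≤⟨ ∑²-mono pointwise ⟩
  ∑² (λ i j → w i j + δ c d i j)           ≡⟨ ∑²-distrib-+ w (δ c d) ⟩
  ∑² w + ∑² (δ c d)                        ≡⟨ cong (∑² w +_) (∑²-δ c d) ⟩
  ∑² w + 1                                 ∎)
  where open ≤-Reasoning

avoiding₂ : ∀ {n} → Fin n → Fin n → Fin n → Bool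
avoiding₂ y z w = not ⌊ w ≟ y ⌋ ∧ not ⌊ w ≟ z ⌋

∑-avoiding₂ : ∀ {n} {y z : Fin n} → y ≢ z → ∑[ w < n ] ⟦ avoiding₂ y z w ⟧ + 2 ≡ n
∑-avoiding₂ {n} {y} {z} y≢z = begin
  ∑[ w < n ] α w + 2
    ≡⟨ cong (∑[ w < n ] α w +_) (sym (cong₂ _+_ (∑-delta y 1) (∑-delta z 1))) ⟩
  ∑[ w < n ] α w + (∑[ w < n ] dy w + ∑[ w < n ] dz w)
    ≡⟨ cong (∑[ w < n ] α w +_) (sym (∑-distrib-+ dy dz)) ⟩
  ∑[ w < n ] α w + ∑[ w < n ] (dy w + dz w)
    ≡⟨ sym (∑-distrib-+ α _) ⟩
  ∑[ w < n ] (α w + (dy w + dz w))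
    ≡⟨ sum-cong-≗ partition ⟩
  ∑[ w < n ] 1
    ≡⟨ ∑-one n ⟩
  n ∎
  where
  open ≡-Reasoning
  α dy dz : Fin n → ℕ
  α w = ⟦ avoiding₂ y z w ⟧
  dy w = if ⌊ w ≟ y ⌋ then 1 else 0
  dz w = if ⌊ w ≟ z ⌋ then 1 else 0
  partition : ∀ w → α w + (dy w + dz w) ≡ 1
  partition w with w ≟ y | w ≟ z
  ... | yes refl | yes refl = contradiction refl y≢z
  ... | yes _ | no _ = refl
  ... | no _ | yes _ = refl
  ... | no _ | no _ = refl

-- The edges {x, w} with β w, each counted once, in increasing orientation: "out" when x is the smaller end.
module Star {n} (x : Fin n) (β : Fin n → Bool) (i j : Fin n) where

  outᵇ inᵇ : Bool
  outᵇ = ⌊ i ≟ x ⌋ ∧ (toℕ i <ᵇ toℕ j) ∧ β j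
  inᵇ = ⌊ j ≟ x ⌋ ∧ (toℕ i <ᵇ toℕ j) ∧ β i

  out-intro : i ≡ x → toℕ i < toℕ j → β j ≡ true → outᵇ ≡ true
  out-intro i≡x i<j βj = ∧-intro (⌊⌋-true (i ≟ x) i≡x) (∧-intro (<ᵇ-true i<j) βj)

  in-intro : j ≡ x → toℕ i < toℕ j → β i ≡ true → inᵇ ≡ true
  in-intro j≡x i<j βi = ∧-intro (⌊⌋-true (j ≟ x) j≡x) (∧-intro (<ᵇ-true i<j) βi)

  out-elim : outᵇ ≡ true → i ≡ x × toℕ i < toℕ j × β j ≡ true
  out-elim e with ∧-elim e
  ... | i≟x , rest with ∧-elim rest
  ... | i<ᵇj , βj = ⌊⌋-true⁻¹ (i ≟ x) i≟x , <ᵇ-true⁻¹ i<ᵇj , βj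

  in-elim : inᵇ ≡ true → j ≡ x × toℕ i < toℕ j × β i ≡ true
  in-elim e with ∧-elim e
  ... | j≟x , rest with ∧-elim rest
  ... | i<ᵇj , βi = ⌊⌋-true⁻¹ (j ≟ x) j≟x , <ᵇ-true⁻¹ i<ᵇj , βi

star : ∀ {n} → Fin n → (Fin n → Bool) → Fin n → Fin n → ℕ
star x β i j = ⟦ Star.outᵇ x β i j ⟧ + ⟦ Star.inᵇ x β i j ⟧

∑²-star : ∀ {n} (x : Fin n) (β : Fin n → Bool) → β x ≡ false → ∑² (star x β) ≡ ∑[ w < n ] ⟦ β w ⟧
∑²-star {n} x β βx≡false = begin
  ∑² (star x β)
    ≡⟨ ∑²-distrib-+ (λ i j → ⟦ outᵇ i j ⟧) (λ i j → ⟦ inᵇ i j ⟧) ⟩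
  ∑² (λ i j → ⟦ outᵇ i j ⟧) + ∑² (λ i j → ⟦ inᵇ i j ⟧)
    ≡⟨ cong₂ _+_ (∑²-row x (λ i j → (toℕ i <ᵇ toℕ j) ∧ β j)) (∑²-column x (λ i j → (toℕ i <ᵇ toℕ j) ∧ β i)) ⟩
  ∑[ w < n ] above w + ∑[ w < n ] below w
    ≡⟨ sym (∑-distrib-+ above below) ⟩
  ∑[ w < n ] (above w + below w)
    ≡⟨ sum-cong-≗ one-side ⟩
  ∑[ w < n ] ⟦ β w ⟧ ∎
  where
  open ≡-Reasoning
  outᵇ inᵇ : Fin n → Fin n → Bool
  outᵇ = Star.outᵇ x β
  inᵇ = Star.inᵇ x β
  above below : Fin n → ℕ
  above w = ⟦ (toℕ x <ᵇ toℕ w) ∧ β w ⟧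
  below w = ⟦ (toℕ w <ᵇ toℕ x) ∧ β w ⟧
  one-side : ∀ w → above w + below w ≡ ⟦ β w ⟧
  one-side w with <-cmp (toℕ x) (toℕ w)
  ... | tri< x<w _ w≮x rewrite <ᵇ-true x<w | <ᵇ-false w≮x = +-identityʳ ⟦ β w ⟧
  ... | tri≈ _ x≡w _ rewrite sym (toℕ-injective x≡w) | βx≡false | ∧-zeroʳ (toℕ x <ᵇ toℕ x) = refl
  ... | tri> x≮w _ w<x rewrite <ᵇ-false x≮w | <ᵇ-true w<x = refl

module _ {n} {y z w : Fin n} where

  avoiding₂-intro : w ≢ y → w ≢ z → avoiding₂ y z w ≡ true
  avoiding₂-intro w≢y w≢z = ∧-intro (cong not (⌊⌋-false (w ≟ y) w≢y)) (cong not (⌊⌋-false (w ≟ z) w≢z))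

  avoiding₂-elim : avoiding₂ y z w ≡ true → w ≢ y × w ≢ z
  avoiding₂-elim e with ∧-elim e
  ... | w≢y , w≢z = not⌊⌋-true⁻¹ (w ≟ y) w≢y , not⌊⌋-true⁻¹ (w ≟ z) w≢z

avoiding₂-self : ∀ {n} (y z : Fin n) → avoiding₂ y z y ≡ false
avoiding₂-self y z rewrite ⌊⌋-true (y ≟ y) refl = refl

fillᵇ : ∀ {n} → Adj n → Adj n → Fin n → Fin n → Bool
fillᵇ G H i j = (toℕ i <ᵇ toℕ j) ∧ H i j ∧ not (G i j)

fillCount≡∑² : ∀ {n} (G H : Adj n) → fillCount G H ≡ ∑² (λ i j → ⟦ fillᵇ G H i j ⟧)
fillCount≡∑² {n} G H = begin
  fillCount G H
    ≡⟨ listSum-cartesianProduct (λ (i , j) → ⟦ fillᵇ G H i j ⟧) (allFin n) (allFin n) ⟩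
  listSum (map (λ i → listSum (map (λ j → ⟦ fillᵇ G H i j ⟧) (allFin n))) (allFin n))
    ≡⟨ cong listSum (map-cong (λ i → listSum-allFin (λ j → ⟦ fillᵇ G H i j ⟧)) (allFin n)) ⟩
  listSum (map (λ i → ∑[ j < n ] ⟦ fillᵇ G H i j ⟧) (allFin n))
    ≡⟨ listSum-allFin (λ i → ∑[ j < n ] ⟦ fillᵇ G H i j ⟧) ⟩
  ∑² (λ i j → ⟦ fillᵇ G H i j ⟧) ∎
  where open ≡-Reasoning

module _ {n} (G H : Adj n) {i j : Fin n} where

  fillᵇ-intro : toℕ i < toℕ j → H i j ≡ true → G i j ≡ false → fillᵇ G H i j ≡ true
  fillᵇ-intro i<j Hij Gij rewrite <ᵇ-true i<j | Hij | Gij = refl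

  fillᵇ-elim : fillᵇ G H i j ≡ true → toℕ i < toℕ j × H i j ≡ true × G i j ≡ false
  fillᵇ-elim e with ∧-elim e
  ... | i<ᵇj , rest with ∧-elim rest
  ... | Hij , ¬Gij = <ᵇ-true⁻¹ i<ᵇj , Hij , not-true⁻¹ ¬Gij

adj-sym : ∀ {n} {G : Adj n} {a b : Fin n} {c : Bool} → IsGraph G → G a b ≡ c → G b a ≡ c
adj-sym {a = a} {b} gG e = trans (IsGraph.sym gG b a) e

adj-≢ : ∀ {n} {G : Adj n} {a b : Fin n} → IsGraph G → G a b ≡ true → a ≢ b
adj-≢ {a = a} gG e refl = true≢false e (IsGraph.irrefl gG a)

module _ {n} (G : Adj n) (x : Fin n) where

  makeUniversal-away : ∀ {p q} → p ≢ x → q ≢ x → makeUniversal G x p q ≡ G p q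
  makeUniversal-away {p} {q} p≢x q≢x
    rewrite ⌊⌋-false (p ≟ x) p≢x | ⌊⌋-false (q ≟ x) q≢x =
    trans (cong (G p q ∨_) (∧-zeroʳ (not ⌊ p ≟ q ⌋))) (∨-identityʳ (G p q))

  makeUniversal-at : ∀ {p q} → p ≢ q → p ≡ x ⊎ q ≡ x → makeUniversal G x p q ≡ true
  makeUniversal-at {p} {q} p≢q (inj₁ p≡x) rewrite ⌊⌋-false (p ≟ q) p≢q | ⌊⌋-true (p ≟ x) p≡x =
    ∨-zeroʳ (G p q)
  makeUniversal-at {p} {q} p≢q (inj₂ q≡x) rewrite ⌊⌋-false (p ≟ q) p≢q | ⌊⌋-true (q ≟ x) q≡x =
    trans (cong (G p q ∨_) (∨-zeroʳ ⌊ p ≟ x ⌋)) (∨-zeroʳ (G p q))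

  makeUniversal-⊇ : ∀ p q → G p q ≡ true → makeUniversal G x p q ≡ true
  makeUniversal-⊇ p q Gpq rewrite Gpq = refl

  makeUniversal-new : ∀ {p q} → makeUniversal G x p q ≡ true → G p q ≡ false → p ≢ q × (p ≡ x ⊎ q ≡ x)
  makeUniversal-new {p} {q} e Gpq rewrite Gpq with ∧-elim e
  ... | p≢q , at-x = not⌊⌋-true⁻¹ (p ≟ q) p≢q , ⊎-map (⌊⌋-true⁻¹ (p ≟ x)) (⌊⌋-true⁻¹ (q ≟ x)) (∨-elim at-x)
    where
    ∨-elim : ∀ {a b} → a ∨ b ≡ true → a ≡ true ⊎ b ≡ true
    ∨-elim {true} _ = inj₁ refl
    ∨-elim {false} b≡true = inj₂ b≡true

  makeUniversal-isGraph : IsGraph G → IsGraph (makeUniversal G x)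
  makeUniversal-isGraph gG = record { sym = symmetric ; irrefl = irreflexive }
    where
    symmetric : ∀ p q → makeUniversal G x p q ≡ makeUniversal G x q p
    symmetric p q rewrite IsGraph.sym gG p q with p ≟ q | q ≟ p
    ... | yes _ | yes _ = refl
    ... | yes p≡q | no q≢p = contradiction (sym p≡q) q≢p
    ... | no p≢q | yes q≡p = contradiction (sym q≡p) p≢q
    ... | no _ | no _ = cong (G q p ∨_) (∨-comm ⌊ p ≟ x ⌋ ⌊ q ≟ x ⌋)
    irreflexive : ∀ p → makeUniversal G x p p ≡ false
    irreflexive p rewrite IsGraph.irrefl gG p | ⌊⌋-true (p ≟ p) refl = refl

  -- Every vertex of an induced P4 has a non-neighbour in it, so the new universal vertex x is not one of them.
  makeUniversal-inducesP4 : ∀ {X} → InducesP4 (makeUniversal G x) X → InducesP4 G X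
  makeUniversal-inducesP4
    (a , b , c , d , a≢b , a≢c , a≢d , b≢c , b≢d , c≢d , X≡ , ab , bc , cd , ¬ac , ¬ad , ¬bd) =
    a , b , c , d , a≢b , a≢c , a≢d , b≢c , b≢d , c≢d , X≡ ,
    in-G a≠x b≠x ab , in-G b≠x c≠x bc , in-G c≠x d≠x cd ,
    in-G a≠x c≠x ¬ac , in-G a≠x d≠x ¬ad , in-G b≠x d≠x ¬bd
    where
    M = makeUniversal G x
    left≢x : ∀ {p q} → p ≢ q → M p q ≡ false → p ≢ x
    left≢x p≢q ¬Mpq p≡x = true≢false (makeUniversal-at p≢q (inj₁ p≡x)) ¬Mpq
    right≢x : ∀ {p q} → p ≢ q → M p q ≡ false → q ≢ x
    right≢x p≢q ¬Mpq q≡x = true≢false (makeUniversal-at p≢q (inj₂ q≡x)) ¬Mpq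
    a≠x = left≢x a≢c ¬ac
    b≠x = left≢x b≢d ¬bd
    c≠x = right≢x a≢c ¬ac
    d≠x = right≢x a≢d ¬ad
    in-G : ∀ {p q c} → p ≢ x → q ≢ x → M p q ≡ c → G p q ≡ c
    in-G p≢x q≢x e = trans (sym (makeUniversal-away p≢x q≢x)) e

  makeUniversal-P4Sparse : P4Sparse G → P4Sparse (makeUniversal G x)
  makeUniversal-P4Sparse sparse Z X Y ∣Z∣≡5 X⊆Z Y⊆Z P4X P4Y =
    sparse Z X Y ∣Z∣≡5 X⊆Z Y⊆Z (makeUniversal-inducesP4 P4X) (makeUniversal-inducesP4 P4Y)

  makeUniversal-solution : ∀ {u v} → IsGraph G → P4Sparse G → u ≢ v → u ≡ x ⊎ v ≡ x →
    Solution G u v (makeUniversal G x)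
  makeUniversal-solution gG sparse u≢v uv∋x =
    makeUniversal-isGraph gG , makeUniversal-P4Sparse sparse , makeUniversal-⊇ , makeUniversal-at u≢v uv∋x

  fillᵇ-makeUniversal-away : ∀ {a b} → a ≢ x → b ≢ x → fillᵇ G (makeUniversal G x) a b ≡ false
  fillᵇ-makeUniversal-away {a} {b} a≢x b≢x = begin
    (toℕ a <ᵇ toℕ b) ∧ makeUniversal G x a b ∧ not (G a b)
      ≡⟨ cong (λ m → (toℕ a <ᵇ toℕ b) ∧ m ∧ not (G a b)) (makeUniversal-away a≢x b≢x) ⟩
    (toℕ a <ᵇ toℕ b) ∧ G a b ∧ not (G a b)
      ≡⟨ cong ((toℕ a <ᵇ toℕ b) ∧_) (∧-inverseʳ (G a b)) ⟩
    (toℕ a <ᵇ toℕ b) ∧ false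
      ≡⟨ ∧-zeroʳ (toℕ a <ᵇ toℕ b) ⟩
    false ∎
    where open ≡-Reasoning

optimal-≤ : ∀ {n} {G : Adj n} {u v : Fin n} {H H′ : Adj n} →
  Solution G u v H′ → fillCount G H′ ≤ fillCount G H → Optimal G u v H → Optimal G u v H′
optimal-≤ solution H′≤H (_ , H-minimal) = solution , λ H″ s → ≤-trans H′≤H (H-minimal H″ s)

module _ {n} {G : Adj n} where

  reach-++ : ∀ {a b c} → Reach G a b → Reach G b c → Reach G a c
  reach-++ here q = q
  reach-++ (step e p) q = step e (reach-++ p q)

  reach-sym : IsGraph G → ∀ {a b} → Reach G a b → Reach G b a
  reach-sym gG here = here
  reach-sym gG (step e p) = reach-++ (reach-sym gG p) (step (adj-sym gG e) here)

∣p∪q∣≤∣p∣+∣q∣ : ∀ {n} (p q : Subset n) → ∣ p ∪ q ∣ ≤ ∣ p ∣ + ∣ q ∣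
∣p∪q∣≤∣p∣+∣q∣ [] [] = z≤n
∣p∪q∣≤∣p∣+∣q∣ (true ∷ p) (true ∷ q) = s≤s (≤-trans (∣p∪q∣≤∣p∣+∣q∣ p q) (+-monoʳ-≤ ∣ p ∣ (n≤1+n ∣ q ∣)))
∣p∪q∣≤∣p∣+∣q∣ (true ∷ p) (false ∷ q) = s≤s (∣p∪q∣≤∣p∣+∣q∣ p q)
∣p∪q∣≤∣p∣+∣q∣ (false ∷ p) (true ∷ q) = ≤-trans (s≤s (∣p∪q∣≤∣p∣+∣q∣ p q)) (≤-reflexive (sym (+-suc ∣ p ∣ ∣ q ∣)))
∣p∪q∣≤∣p∣+∣q∣ (false ∷ p) (false ∷ q) = ∣p∪q∣≤∣p∣+∣q∣ p q

∃∈-avoiding₂ : ∀ {n} {K : Subset n} → 3 ≤ ∣ K ∣ → ∀ e₁ e₂ → ∃[ k ] k ∈ K × k ≢ e₁ × k ≢ e₂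
∃∈-avoiding₂ {K = K} 3≤∣K∣ e₁ e₂ with any? (λ k → (k ∈? K) ×-dec ¬? (k ≟ e₁) ×-dec ¬? (k ≟ e₂))
... | yes found = found
... | no none = contradiction (≤-trans 3≤∣K∣ (≤-trans (p⊆q⇒∣p∣≤∣q∣ K⊆pair) ∣pair∣≤2)) (<-irrefl refl)
  where
  K⊆pair : K ⊆ ⁅ e₁ ⁆ ∪ ⁅ e₂ ⁆
  K⊆pair {k} k∈K with k ≟ e₁ | k ≟ e₂
  ... | yes refl | _ = x∈p∪q⁺ (inj₁ (x∈⁅x⁆ k))
  ... | no _ | yes refl = x∈p∪q⁺ (inj₂ (x∈⁅x⁆ k))
  ... | no k≢e₁ | no k≢e₂ = contradiction (k , k∈K , k≢e₁ , k≢e₂) none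
  ∣pair∣≤2 : ∣ ⁅ e₁ ⁆ ∪ ⁅ e₂ ⁆ ∣ ≤ 2
  ∣pair∣≤2 = ≤-trans (∣p∪q∣≤∣p∣+∣q∣ ⁅ e₁ ⁆ ⁅ e₂ ⁆) (≤-reflexive (cong₂ _+_ (∣⁅x⁆∣≡1 e₁) (∣⁅x⁆∣≡1 e₂)))

AdjacentToAllBut : ∀ {n} → Adj n → Fin n → Fin n → Set
AdjacentToAllBut H x s = ∀ w → w ≢ x → w ≢ s → H x w ≡ true

module _ {n} {H : Adj n} {S K R : Subset n} where

  thickSpider-S∪K-edge : IsGraph H → IsThickSpider H S K R →
    ∀ {x y} → x ∈ S ∪ K → H x y ≡ true → x ∈ K ⊎ y ∈ K
  thickSpider-S∪K-edge gH (partition , S-indep , _ , _ , _ , _ , RS , _) {x} {y} x∈S∪K Hxy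
    with x∈p∪q⁻ S K x∈S∪K
  ... | inj₂ x∈K = inj₁ x∈K
  ... | inj₁ x∈S with partition y
  ...   | inj₁ (y∈S , _) = contradiction (S-indep x y x∈S y∈S) (true≢false Hxy)
  ...   | inj₂ (inj₁ (_ , y∈K , _)) = inj₂ y∈K
  ...   | inj₂ (inj₂ (_ , _ , y∈R)) = contradiction (RS y x y∈R x∈S) (true≢false (adj-sym gH Hxy))

  thickSpider-almostUniversal : IsGraph H → IsThickSpider H S K R → ∀ {x} → x ∈ K →
    ∃[ s ] s ≢ x × AdjacentToAllBut H x s
  thickSpider-almostUniversal gH (partition , _ , K-clique , _ , _ , RK , _ , f , _ , f-inj , f-onto , thick) {x} x∈K =
    s , s≢x , adjacent
    where
    s = proj₁ (f-onto x x∈K)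
    s∈S = proj₁ (proj₂ (f-onto x x∈K))
    fs≡x = proj₂ (proj₂ (f-onto x x∈K))
    s≢x : s ≢ x
    s≢x s≡x with partition s
    ... | inj₁ (_ , s∉K , _) = s∉K (subst (_∈ K) (sym s≡x) x∈K)
    ... | inj₂ (inj₁ (s∉S , _)) = s∉S s∈S
    ... | inj₂ (inj₂ (s∉S , _)) = s∉S s∈S
    adjacent : AdjacentToAllBut H x s
    adjacent w w≢x w≢s with partition w
    ... | inj₁ (w∈S , _) =
      adj-sym gH (proj₂ (thick w x w∈S x∈K) λ x≡fw → w≢s (f-inj w s w∈S s∈S (trans (sym x≡fw) (sym fs≡x))))
    ... | inj₂ (inj₁ (_ , w∈K , _)) = K-clique x w x∈K w∈K (w≢x ∘ sym)
    ... | inj₂ (inj₂ (_ , _ , w∈R)) = adj-sym gH (RK w x w∈R x∈K)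

  thickSpider-3≤∣K∣ : IsThickSpider H S K R → 3 ≤ ∣ K ∣
  thickSpider-3≤∣K∣ (_ , _ , _ , ∣S∣≡∣K∣ , 3≤∣S∣ , _) = subst (3 ≤_) ∣S∣≡∣K∣ 3≤∣S∣

  thickSpider-K-neighbour : IsThickSpider H S K R → ∀ x a → ∃[ k ] k ∈ K × k ≢ x × H a k ≡ true
  thickSpider-K-neighbour spider@(partition , _ , K-clique , _ , _ , RK , _ , f , _ , _ , _ , thick) x a
    with partition a
  ... | inj₁ (a∈S , _) =
    let k , k∈K , k≢x , k≢fa = ∃∈-avoiding₂ (thickSpider-3≤∣K∣ spider) x (f a)
    in k , k∈K , k≢x , proj₂ (thick a k a∈S k∈K) k≢fa
  ... | inj₂ (inj₁ (_ , a∈K , _)) =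
    let k , k∈K , k≢x , k≢a = ∃∈-avoiding₂ (thickSpider-3≤∣K∣ spider) x a
    in k , k∈K , k≢x , K-clique a k a∈K k∈K (k≢a ∘ sym)
  ... | inj₂ (inj₂ (_ , _ , a∈R)) =
    let k , k∈K , k≢x , _ = ∃∈-avoiding₂ (thickSpider-3≤∣K∣ spider) x x
    in k , k∈K , k≢x , RK a k a∈R k∈K

  thickSpider-reach : ∀ {G : Adj n} {x : Fin n} → IsGraph H → IsThickSpider H S K R →
    (∀ {a b} → a ≢ x → b ≢ x → H a b ≡ true → G a b ≡ true) →
    ∀ {a b} → a ≢ x → b ≢ x → Reach G a b
  thickSpider-reach {G} {x} gH spider@(_ , _ , K-clique , _) H⇒G {a} {b} a≢x b≢x
    with thickSpider-K-neighbour spider x a | thickSpider-K-neighbour spider x b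
  ... | k , k∈K , k≢x , Hak | l , l∈K , l≢x , Hbl =
    step (H⇒G a≢x k≢x Hak) (reach-++ k⇝l (step (H⇒G l≢x b≢x (adj-sym gH Hbl)) here))
    where
    k⇝l : Reach G k l
    k⇝l with k ≟ l
    ... | yes refl = here
    ... | no k≢l = step (H⇒G k≢x l≢x (K-clique k l k∈K l∈K k≢l)) here

SamePair : ∀ {n} → Fin n → Fin n → Fin n → Fin n → Set
SamePair x s i j = (i ≡ x × j ≡ s) ⊎ (i ≡ s × j ≡ x)

sortPair : ∀ {n} {x s : Fin n} → x ≢ s → ∃₂ λ p q → toℕ p < toℕ q × SamePair x s p q
sortPair {x = x} {s} x≢s with <-cmp (toℕ x) (toℕ s)
... | tri< x<s _ _ = x , s , x<s , inj₁ (refl , refl)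
... | tri≈ _ x≡s _ = contradiction (toℕ-injective x≡s) x≢s
... | tri> _ _ s<x = s , x , s<x , inj₂ (refl , refl)

samePair-sorted : ∀ {n} {x s i j p q : Fin n} → toℕ i < toℕ j → toℕ p < toℕ q →
  SamePair x s i j → SamePair x s p q → i ≡ p × j ≡ q
samePair-sorted _ _ (inj₁ (refl , refl)) (inj₁ (refl , refl)) = refl , refl
samePair-sorted i<j p<q (inj₁ (refl , refl)) (inj₂ (refl , refl)) = contradiction p<q (<-asym i<j)
samePair-sorted i<j p<q (inj₂ (refl , refl)) (inj₁ (refl , refl)) = contradiction p<q (<-asym i<j)
samePair-sorted _ _ (inj₂ (refl , refl)) (inj₂ (refl , refl)) = refl , refl

FillEdgeAvoiding : ∀ {n} → Adj n → Adj n → Fin n → Set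
FillEdgeAvoiding G H x = ∃₂ λ a b → a ≢ x × b ≢ x × fillᵇ G H a b ≡ true

fillEdgeAvoiding? : ∀ {n} (G H : Adj n) (x : Fin n) → Dec (FillEdgeAvoiding G H x)
fillEdgeAvoiding? G H x =
  any? λ a → any? λ b → ¬? (a ≟ x) ×-dec ¬? (b ≟ x) ×-dec (fillᵇ G H a b Bool.≟ true)

no-fillEdgeAvoiding : ∀ {n} {G H : Adj n} {x : Fin n} → IsGraph G → IsGraph H → ¬ FillEdgeAvoiding G H x →
  ∀ {a b} → a ≢ x → b ≢ x → H a b ≡ true → G a b ≡ true
no-fillEdgeAvoiding {G = G} {H} gG gH ¬fill {a} {b} a≢x b≢x Hab with G a b in Gab
... | true = refl
... | false with <-cmp (toℕ a) (toℕ b)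
...   | tri< a<b _ _ = contradiction (a , b , a≢x , b≢x , fillᵇ-intro G H a<b Hab Gab) ¬fill
...   | tri≈ _ a≡b _ = contradiction (toℕ-injective a≡b) (adj-≢ gH Hab)
...   | tri> _ _ b<a = contradiction (b , a , b≢x , a≢x , fillᵇ-intro G H b<a (adj-sym gH Hab) (adj-sym gG Gab)) ¬fill

module _ {n} {H : Adj n} {x s : Fin n} (gH : IsGraph H) (s≢x : s ≢ x) (adjacent : AdjacentToAllBut H x s) where

  incident-edge-in-H : ∀ {i j} → i ≢ j → i ≡ x ⊎ j ≡ x → H i j ≡ true ⊎ SamePair x s i j
  incident-edge-in-H {i} {j} i≢j (inj₁ refl) with j ≟ s
  ... | yes j≡s = inj₂ (inj₁ (refl , j≡s))
  ... | no j≢s = inj₁ (adjacent j (i≢j ∘ sym) j≢s)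
  incident-edge-in-H {i} {j} i≢j (inj₂ refl) with i ≟ s
  ... | yes i≡s = inj₂ (inj₂ (i≡s , refl))
  ... | no i≢s = inj₁ (adj-sym gH (adjacent i i≢j i≢s))

  -- Pointwise, {x, s} is the only possible new edge outside H; it is traded for the fill edge avoiding x.
  exchange : ∀ {G} → FillEdgeAvoiding G H x → fillCount G (makeUniversal G x) ≤ fillCount G H
  exchange {G} (a , b , a≢x , b≢x , fill-ab) with sortPair (s≢x ∘ sym)
  ... | p , q , p<q , pq≡xs = begin
    fillCount G M                       ≡⟨ fillCount≡∑² G M ⟩
    ∑² (λ i j → ⟦ fillᵇ G M i j ⟧)      ≤⟨ ∑²-exchange a b p q trade ⟩
    ∑² (λ i j → ⟦ fillᵇ G H i j ⟧)      ≡⟨ sym (fillCount≡∑² G H) ⟩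
    fillCount G H                       ∎
    where
    open ≤-Reasoning
    M = makeUniversal G x
    M-fill⇒ : ∀ i j → fillᵇ G M i j ≡ true → fillᵇ G H i j ≡ true ⊎ (⌊ i ≟ p ⌋ ∧ ⌊ j ≟ q ⌋) ≡ true
    M-fill⇒ i j fill-ij with fillᵇ-elim G M fill-ij
    ... | i<j , Mij , ¬Gij with makeUniversal-new G x Mij ¬Gij
    ...   | i≢j , at-x with incident-edge-in-H i≢j at-x
    ...     | inj₁ Hij = inj₁ (fillᵇ-intro G H i<j Hij ¬Gij)
    ...     | inj₂ ij≡xs with samePair-sorted i<j p<q ij≡xs pq≡xs
    ...       | i≡p , j≡q = inj₂ (∧-intro (⌊⌋-true (i ≟ p) i≡p) (⌊⌋-true (j ≟ q) j≡q))
    ab-fill⇒ : ∀ i j → (⌊ i ≟ a ⌋ ∧ ⌊ j ≟ b ⌋) ≡ true → fillᵇ G M i j ≡ false × fillᵇ G H i j ≡ true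
    ab-fill⇒ i j e with ⌊⌋-true⁻¹ (i ≟ a) (proj₁ (∧-elim e)) | ⌊⌋-true⁻¹ (j ≟ b) (proj₂ (∧-elim e))
    ... | refl | refl = fillᵇ-makeUniversal-away G x a≢x b≢x , fill-ab
    trade : ∀ i j → ⟦ fillᵇ G M i j ⟧ + δ a b i j ≤ ⟦ fillᵇ G H i j ⟧ + δ p q i j
    trade i j = ⟦⟧-exchange (M-fill⇒ i j) (ab-fill⇒ i j)

  -- Both sides have n − 2 edges at a single vertex: the new edges at y avoid z, while H joins the isolated x
  -- to every vertex but s.
  isolated-swap : ∀ {G y z} → IsGraph G → (∀ w → G x w ≡ false) → G y z ≡ true →
    fillCount G (makeUniversal G y) ≤ fillCount G H
  isolated-swap {G} {y} {z} gG isolated Gyz = begin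
    fillCount G M                       ≡⟨ fillCount≡∑² G M ⟩
    ∑² (λ i j → ⟦ fillᵇ G M i j ⟧)      ≤⟨ ∑²-mono M-fill≤star ⟩
    ∑² (star y (avoiding₂ y z))         ≡⟨ ∑²-star y (avoiding₂ y z) (avoiding₂-self y z) ⟩
    ∑[ w < n ] ⟦ avoiding₂ y z w ⟧      ≡⟨ +-cancelʳ-≡ 2 _ _ (trans (∑-avoiding₂ y≢z) (sym (∑-avoiding₂ x≢s))) ⟩
    ∑[ w < n ] ⟦ avoiding₂ x s w ⟧      ≡⟨ sym (∑²-star x (avoiding₂ x s) (avoiding₂-self x s)) ⟩
    ∑² (star x (avoiding₂ x s))         ≤⟨ ∑²-mono star≤H-fill ⟩
    ∑² (λ i j → ⟦ fillᵇ G H i j ⟧)      ≡⟨ sym (fillCount≡∑² G H) ⟩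
    fillCount G H                       ∎
    where
    open ≤-Reasoning
    M = makeUniversal G y
    y≢z = adj-≢ gG Gyz
    x≢s = s≢x ∘ sym
    adjacent-avoiding : ∀ {w} → avoiding₂ x s w ≡ true → H x w ≡ true
    adjacent-avoiding w∉xs = let w≢x , w≢s = avoiding₂-elim w∉xs in adjacent _ w≢x w≢s
    non-neighbour-of-y : ∀ {w} → G y w ≡ false → w ≢ z
    non-neighbour-of-y ¬Gyw refl = true≢false Gyz ¬Gyw
    M-fill≤star : ∀ i j → ⟦ fillᵇ G M i j ⟧ ≤ star y (avoiding₂ y z) i j
    M-fill≤star i j = ⟦⟧-≤-+ M-fill⇒
      where
      open Star y (avoiding₂ y z) i j
      M-fill⇒ : fillᵇ G M i j ≡ true → outᵇ ≡ true ⊎ inᵇ ≡ true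
      M-fill⇒ fill-ij with fillᵇ-elim G M fill-ij
      ... | i<j , Mij , ¬Gij with makeUniversal-new G y Mij ¬Gij
      ...   | i≢j , inj₁ i≡y = inj₁ (out-intro i≡y i<j (avoiding₂-intro (i≢j ∘ trans i≡y ∘ sym)
                                  (non-neighbour-of-y (subst (λ p → G p j ≡ false) i≡y ¬Gij))))
      ...   | i≢j , inj₂ j≡y = inj₂ (in-intro j≡y i<j (avoiding₂-intro (i≢j ∘ flip trans (sym j≡y))
                                  (non-neighbour-of-y (adj-sym gG (subst (λ q → G i q ≡ false) j≡y ¬Gij)))))
    star≤H-fill : ∀ i j → star x (avoiding₂ x s) i j ≤ ⟦ fillᵇ G H i j ⟧
    star≤H-fill i j = ⟦⟧-+-≤ out⇒fill in⇒fill disjoint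
      where
      open Star x (avoiding₂ x s) i j
      out⇒fill : outᵇ ≡ true → fillᵇ G H i j ≡ true
      out⇒fill e with out-elim e
      ... | refl , i<j , j∉xs = fillᵇ-intro G H i<j (adjacent-avoiding j∉xs) (isolated j)
      in⇒fill : inᵇ ≡ true → fillᵇ G H i j ≡ true
      in⇒fill e with in-elim e
      ... | refl , i<j , i∉xs = fillᵇ-intro G H i<j (adj-sym gH (adjacent-avoiding i∉xs)) (adj-sym gG (isolated i))
      disjoint : outᵇ ≡ true → inᵇ ≡ true → ⊥
      disjoint e₁ e₂ with out-elim e₁ | in-elim e₂
      ... | refl , i<j , _ | refl , _ , _ = <-irrefl refl i<j

thickSpider-universal-bound : ∀ {n} {G H : Adj n} {S K R : Subset n} {x y : Fin n} →
  IsGraph G → IsGraph H → IsThickSpider H S K R → x ∈ K → ¬ Reach G x y →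
  fillCount G (makeUniversal G x) ≤ fillCount G H ⊎ fillCount G (makeUniversal G y) ≤ fillCount G H
thickSpider-universal-bound {G = G} {H} {x = x} {y} gG gH spider x∈K x↛y
  with thickSpider-almostUniversal gH spider x∈K | fillEdgeAvoiding? G H x
... | s , s≢x , adjacent | yes fill = inj₁ (exchange gH s≢x adjacent fill)
... | s , s≢x , adjacent | no ¬fill = inj₂ (isolated-swap gH s≢x adjacent gG x-isolated (proj₂ y-neighbour))
  where
  H⇒G : ∀ {a b} → a ≢ x → b ≢ x → H a b ≡ true → G a b ≡ true
  H⇒G = no-fillEdgeAvoiding gG gH ¬fill
  y≢x : y ≢ x
  y≢x refl = x↛y here
  y-neighbour : ∃[ z ] G y z ≡ true
  y-neighbour = let k , _ , k≢x , Hyk = thickSpider-K-neighbour spider x y in k , H⇒G y≢x k≢x Hyk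
  x-isolated : ∀ w → G x w ≡ false
  x-isolated w with G x w in Gxw
  ... | false = refl
  ... | true = contradiction (step Gxw (thickSpider-reach gH spider H⇒G (adj-≢ gG Gxw ∘ sym) y≢x)) x↛y

lemma10 : ∀ {n} (G : Adj n) (u v : Fin n) →
    IsGraph G → P4Sparse G → TwoComponents G u v →
    (H : Adj n) → Optimal G u v H →
    (S K R : Subset n) → IsThickSpider H S K R →
    (u ∈ S ∪ K ⊎ v ∈ S ∪ K) →
    Optimal G u v (makeUniversal G u) ⊎ Optimal G u v (makeUniversal G v)
lemma10 G u v gG sparse (u↛v , _) H H-optimal@((gH , _ , _ , Huv) , _) S K R spider u∨v∈S∪K =
  [ (λ u∈K → ⊎-map optimal-u optimal-v (bound u∈K u↛v))
  , (λ v∈K → swap (⊎-map optimal-v optimal-u (bound v∈K (u↛v ∘ reach-sym gG))))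
  ]′ u∨v∈K
  where
  bound : ∀ {x y} → x ∈ K → ¬ Reach G x y →
    fillCount G (makeUniversal G x) ≤ fillCount G H ⊎ fillCount G (makeUniversal G y) ≤ fillCount G H
  bound = thickSpider-universal-bound gG gH spider
  u∨v∈K : u ∈ K ⊎ v ∈ K
  u∨v∈K = [ (λ u∈S∪K → thickSpider-S∪K-edge gH spider u∈S∪K Huv)
          , (λ v∈S∪K → swap (thickSpider-S∪K-edge gH spider v∈S∪K (adj-sym gH Huv)))
          ]′ u∨v∈S∪K
  u≢v : u ≢ v
  u≢v refl = u↛v here
  optimal-u : fillCount G (makeUniversal G u) ≤ fillCount G H → Optimal G u v (makeUniversal G u)
  optimal-u = λ ≤H → optimal-≤ (makeUniversal-solution G u gG sparse u≢v (inj₁ refl)) ≤H H-optimal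
  optimal-v : fillCount G (makeUniversal G v) ≤ fillCount G H → Optimal G u v (makeUniversal G v)
  optimal-v = λ ≤H → optimal-≤ (makeUniversal-solution G v gG sparse u≢v (inj₂ refl)) ≤H H-optimal
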